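{- For any matroid $M$ and $t\in\mathbb{N}$, $(M^*)^t=(M^t)^*$ (using the same sets $S_e$ for both expansions). Consequently, if $M$ is self-dual, then so is $M^t$.
   Context: A cyclic flat of a matroid $M$ is a flat $F$ such that $M|F$ has no coloops; $\mathcal{Z}(M)$ denotes the set of cyclic flats, and a matroid is determined by its cyclic flats and their ranks. The $t$-expansion: for each $e\in E(M)$ let $S_e$ be a $t$-element set with $e\in S_e$, the sets $S_e$ pairwise disjoint; for $X\subseteq E(M)$ let $S_X=\bigcup_{e\in X}S_e$. The $t$-expansion $M^t$ is the matroid on $S_{E(M)}$ whose cyclic flats are exactly the sets $S_A$ with $A\in\mathcal{Z}(M)$, with $r_{M^t}(S_A)=t\cdot r_M(A)$. $M^*$ denotes the dual matroid. A matroid is self-dual if it is isomorphic to its dual. -}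

module Defs where

open import Data.Nat using (ℕ; _+_; _*_; _∸_; _≤_; _<_)
open import Data.Fin using (Fin)
open import Data.Fin.Subset using (Subset; _∈_; _∉_; _⊆_; ∁; _∩_; _∪_; _-_; ⁅_⁆; ∣_∣; ⊤)
open import Data.Vec using (tabulate; lookup)
open import Data.Fin.Permutation using (Permutation′; _⟨$⟩ʳ_)
open import Data.Product using (Σ; ∃; _×_)
open import Relation.Binary.PropositionalEquality using (_≡_)

record Matroid (n : ℕ) : Set where
  field
    rank        : Subset n → ℕ
    rank-≤-card : ∀ X → rank X ≤ ∣ X ∣
    rank-mono   : ∀ {X Y} → X ⊆ Y → rank X ≤ rank Y
    rank-submod : ∀ X Y → rank (X ∪ Y) + rank (X ∩ Y) ≤ rank X + rank Y
open Matroid public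

dualRank : ∀ {n} → Matroid n → Subset n → ℕ
dualRank M X = (∣ X ∣ + rank M (∁ X)) ∸ rank M ⊤

-- Flats and cyclic flats, phrased for an arbitrary rank function
-- (so they apply both to M and to the dual rank function of M).
IsFlat : ∀ {n} → (Subset n → ℕ) → Subset n → Set
IsFlat r F = ∀ e → e ∉ F → r F < r (F ∪ ⁅ e ⁆)

NoColoops : ∀ {n} → (Subset n → ℕ) → Subset n → Set
NoColoops r F = ∀ e → e ∈ F → r (F - e) ≡ r F

IsCyclicFlat : ∀ {n} → (Subset n → ℕ) → Subset n → Set
IsCyclicFlat r F = IsFlat r F × NoColoops r F

-- The blocks S_e are encoded by a map p : Fin m → Fin n from the expanded
-- ground set to E(M): S_e = p⁻¹(e).  S_X = p⁻¹(X).
S[_] : ∀ {m n} → (Fin m → Fin n) → Subset n → Subset m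
S[ p ] X = tabulate (λ i → lookup X (p i))

BlocksOfSize : ∀ {m n} → (Fin m → Fin n) → ℕ → Set
BlocksOfSize {n = n} p t = ∀ (e : Fin n) → ∣ S[ p ] ⁅ e ⁆ ∣ ≡ t

-- s is the rank function of the t-expansion (w.r.t. blocks p) of the
-- matroid with rank function r: its cyclic flats are exactly the S_A with
-- A a cyclic flat of r, and s(S_A) = t · r(A).
-- (A matroid is determined by its cyclic flats and their ranks.)
IsExpansion : ∀ {m n} → (Fin m → Fin n) → ℕ →
              (Subset n → ℕ) → (Subset m → ℕ) → Set
IsExpansion {m} {n} p t r s =
  (∀ (Z : Subset m) → IsCyclicFlat s Z → ∃ λ (A : Subset n) → IsCyclicFlat r A × Z ≡ S[ p ] A)
  × (∀ (A : Subset n) → IsCyclicFlat r A → IsCyclicFlat s (S[ p ] A))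
  × (∀ (A : Subset n) → IsCyclicFlat r A → s (S[ p ] A) ≡ t * r A)

Isomorphic : ∀ {n} → (Subset n → ℕ) → (Subset n → ℕ) → Set
Isomorphic {n} r s = Σ (Permutation′ n) λ π →
  ∀ (X : Subset n) → s (tabulate (λ i → lookup X (π ⟨$⟩ʳ i))) ≡ r X

SelfDual : ∀ {n} → Matroid n → Set
SelfDual M = Isomorphic (rank M) (dualRank M)

{-# OPTIONS --safe #-}
module Submission where

-- The rank of a matroid is r X = min (r Z + ∣ X ─ Z ∣) over its cyclic flats Z, so a matroid is
-- determined by its cyclic flats and their ranks. Feeding the cyclic flats S_A of M^t into this
-- formula gives r_{M^t}(S_X) = t · r_M(X) for every X, and hence r*_{M^t}(S_X) = t · r*_M(X).
-- The cyclic flats of a dual are the complements of the cyclic flats, and S_(E − A) = E' − S_A,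
-- so the cyclic flats of (M^t)* are exactly the S_A with A cyclic in M*: (M^t)* = (M*)^t.
-- If π : M ≅ M*, then, since all blocks have size t, π lifts to a permutation σ of the expanded
-- ground set with p ∘ σ = π ∘ p (p maps S_e to e); relabelling (M^t)* = (M*)^t along σ gives a
-- t-expansion of M, which must be M^t itself.

open import Defs
import Algebra.Lattice.Properties.BooleanAlgebra as BooleanAlgebraProperties
open import Algebra.Properties.CommutativeSemigroup using (interchange)
open import Data.Bool using (Bool; true; not)
open import Data.Fin using (Fin; zero; suc; punchIn; _≟_)
open import Data.Fin.Permutation using (Permutation′; _⟨$⟩ʳ_; _⟨$⟩ˡ_; inverseˡ; inverseʳ; insert; insert-punchIn)
import Data.Fin.Permutation as Permutation
open import Data.Fin.Properties using (any?)
open import Data.Fin.Subset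
  using (Subset; inside; outside; _∈_; _∉_; _⊆_; _⊂_; _⊃_; ∁; _∩_; _∪_; _─_; _-_; ⁅_⁆; ∣_∣; ⊤; Nonempty; Empty)
open import Data.Fin.Subset.Properties
  using ( _∈?_; nonempty?; drop-there; Empty-unique; ∣⊥∣≡0; ∣⁅x⁆∣≡1; x∈⁅x⁆; x∈⁅y⁆⇒x≡y; ⊆-refl; ⊆-trans; ⊆-antisym; ⊆⊤
        ; p⊂q⇒∣p∣<∣q∣; p⊆q⇒∣p∣≤∣q∣; x∈p⇒x∉∁p; x∈∁p⇒x∉p; x∉∁p⇒x∈p; x∉p⇒x∈∁p; ∪-inverseˡ; ∪-∩-booleanAlgebra
        ; p⊆p∪q; q⊆p∪q; x∈p∪q⁻; x∈p∩q⁻; p─q⊆p; p─q─r≡p─r─q; x∈p∧x∉q⇒x∈p─q; x∈p∧x≢y⇒x∈p-y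
        ; x∈p⇒p-x⊂p; x∈p⇒∣p-x∣<∣p∣ )
open import Data.Fin.Subset.Induction using (⊂-wellFounded; ⊃-wellFounded)
open import Data.Nat using (ℕ; zero; suc; _+_; _*_; _∸_; _≤_; _<_; _≤?_; _<?_; s≤s; s≤s⁻¹)
open import Data.Nat.Properties hiding (_≟_)
open import Data.Product using (Σ; ∃; _×_; _,_; proj₁; proj₂)
open import Data.Sum using (_⊎_; inj₁; inj₂)
open import Data.Vec using (_∷_; []; tabulate; lookup; zipWith; here; there)
open import Data.Vec.Properties using (lookup∘tabulate; tabulate∘lookup; tabulate-cong; lookup-zipWith; lookup-map; lookup-replicate; []=⇒lookup; lookup⇒[]=)
open import Function using (_∘_; id; _⇔_; mk⇔; Equivalence)
open import Induction.WellFounded using (Acc; acc)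
open import Relation.Binary.PropositionalEquality
open import Relation.Nullary using (yes; no; ¬?; contradiction)
open import Relation.Nullary.Decidable using (_×-dec_)

private
  variable
    k m n : ℕ

module SubsetBA {n : ℕ} = BooleanAlgebraProperties (∪-∩-booleanAlgebra n)

pointwise : {X Y : Subset n} → (∀ i → lookup X i ≡ lookup Y i) → X ≡ Y
pointwise {X = X} {Y} X≗Y = begin
  X                   ≡⟨ tabulate∘lookup X ⟨
  tabulate (lookup X) ≡⟨ tabulate-cong X≗Y ⟩
  tabulate (lookup Y) ≡⟨ tabulate∘lookup Y ⟩
  Y                   ∎
  where open ≡-Reasoning

x∈p─q⇒x∉q : ∀ {x : Fin n} (p q : Subset n) → x ∈ p ─ q → x ∉ q
x∈p─q⇒x∉q (inside  ∷ p) (outside ∷ q) here ()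
x∈p─q⇒x∉q {x = zero} (outside ∷ p) (outside ∷ q) ()
x∈p─q⇒x∉q {x = zero} (_       ∷ p) (inside  ∷ q) ()
x∈p─q⇒x∉q (_       ∷ p) (_       ∷ q) (there x∈p─q) = x∈p─q⇒x∉q p q x∈p─q ∘ drop-there

─≡∩∁ : ∀ (p q : Subset n) → p ─ q ≡ p ∩ ∁ q
─≡∩∁ []            []            = refl
─≡∩∁ (inside  ∷ p) (inside  ∷ q) = cong (outside ∷_) (─≡∩∁ p q)
─≡∩∁ (inside  ∷ p) (outside ∷ q) = cong (inside  ∷_) (─≡∩∁ p q)
─≡∩∁ (outside ∷ p) (inside  ∷ q) = cong (outside ∷_) (─≡∩∁ p q)
─≡∩∁ (outside ∷ p) (outside ∷ q) = cong (outside ∷_) (─≡∩∁ p q)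

∁-∪ : ∀ (p q : Subset n) → ∁ (p ∪ q) ≡ ∁ p ─ q
∁-∪ p q = trans (SubsetBA.deMorgan₂ p q) (sym (─≡∩∁ (∁ p) q))

∁-─ : ∀ (p q : Subset n) → ∁ (p ─ q) ≡ ∁ p ∪ q
∁-─ p q = trans (cong ∁ (─≡∩∁ p q)) (trans (SubsetBA.deMorgan₁ p (∁ q)) (cong (∁ p ∪_) (SubsetBA.¬-involutive q)))

─-monoˡ-⊆ : ∀ {p q : Subset n} (s : Subset n) → p ⊆ q → p ─ s ⊆ q ─ s
─-monoˡ-⊆ {p = p} s p⊆q x∈p─s = x∈p∧x∉q⇒x∈p─q (p⊆q (p─q⊆p p s x∈p─s)) (x∈p─q⇒x∉q p s x∈p─s)

p⊂p∪⁅x⁆ : ∀ {p : Subset n} {x} → x ∉ p → p ⊂ p ∪ ⁅ x ⁆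
p⊂p∪⁅x⁆ {x = x} x∉p = p⊆p∪q ⁅ x ⁆ , x , q⊆p∪q _ ⁅ x ⁆ (x∈⁅x⁆ x) , x∉p

p⊆p∪⁅x⁆-x : ∀ {p : Subset n} {x} → x ∉ p → p ⊆ (p ∪ ⁅ x ⁆) - x
p⊆p∪⁅x⁆-x {x = x} x∉p y∈p = x∈p∧x≢y⇒x∈p-y (p⊆p∪q ⁅ x ⁆ y∈p) λ { refl → x∉p y∈p }

p⊆p-x∪⁅x⁆ : ∀ (p : Subset n) x → p ⊆ (p - x) ∪ ⁅ x ⁆
p⊆p-x∪⁅x⁆ p x {y} y∈p with y ≟ x
... | yes refl = q⊆p∪q _ ⁅ x ⁆ (x∈⁅x⁆ x)
... | no y≢x   = p⊆p∪q ⁅ x ⁆ (x∈p∧x≢y⇒x∈p-y y∈p y≢x)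

p-x∪⁅x⁆≡p : ∀ {p : Subset n} {x} → x ∈ p → (p - x) ∪ ⁅ x ⁆ ≡ p
p-x∪⁅x⁆≡p {p = p} {x} x∈p = ⊆-antisym ⊆p (p⊆p-x∪⁅x⁆ p x)
  where
  ⊆p : (p - x) ∪ ⁅ x ⁆ ⊆ p
  ⊆p y∈ with x∈p∪q⁻ (p - x) ⁅ x ⁆ y∈
  ... | inj₁ y∈p-x = p─q⊆p p ⁅ x ⁆ y∈p-x
  ... | inj₂ y∈⁅x⁆ rewrite x∈⁅y⁆⇒x≡y x y∈⁅x⁆ = x∈p

∣p∪q∣+∣p∩q∣≡∣p∣+∣q∣ : ∀ (p q : Subset n) → ∣ p ∪ q ∣ + ∣ p ∩ q ∣ ≡ ∣ p ∣ + ∣ q ∣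
∣p∪q∣+∣p∩q∣≡∣p∣+∣q∣ []            []            = refl
∣p∪q∣+∣p∩q∣≡∣p∣+∣q∣ (inside  ∷ p) (inside  ∷ q) =
  cong suc (trans (+-suc _ _) (trans (cong suc (∣p∪q∣+∣p∩q∣≡∣p∣+∣q∣ p q)) (sym (+-suc _ _))))
∣p∪q∣+∣p∩q∣≡∣p∣+∣q∣ (inside  ∷ p) (outside ∷ q) = cong suc (∣p∪q∣+∣p∩q∣≡∣p∣+∣q∣ p q)
∣p∪q∣+∣p∩q∣≡∣p∣+∣q∣ (outside ∷ p) (inside  ∷ q) = trans (cong suc (∣p∪q∣+∣p∩q∣≡∣p∣+∣q∣ p q)) (sym (+-suc _ _))
∣p∪q∣+∣p∩q∣≡∣p∣+∣q∣ (outside ∷ p) (outside ∷ q) = ∣p∪q∣+∣p∩q∣≡∣p∣+∣q∣ p q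

∣p∪q∣≤∣p∣+∣q∣ : ∀ (p q : Subset n) → ∣ p ∪ q ∣ ≤ ∣ p ∣ + ∣ q ∣
∣p∪q∣≤∣p∣+∣q∣ p q = ≤-trans (m≤m+n _ _) (≤-reflexive (∣p∪q∣+∣p∩q∣≡∣p∣+∣q∣ p q))

Empty⇒∣p∣≡0 : ∀ {p : Subset n} → Empty p → ∣ p ∣ ≡ 0
Empty⇒∣p∣≡0 {n = n} empty = trans (cong ∣_∣ (Empty-unique empty)) (∣⊥∣≡0 n)

∣p∪q∣≡∣p∣+∣q∣ : ∀ (p q : Subset n) → Empty (p ∩ q) → ∣ p ∪ q ∣ ≡ ∣ p ∣ + ∣ q ∣
∣p∪q∣≡∣p∣+∣q∣ p q disjoint = begin
  ∣ p ∪ q ∣              ≡⟨ +-identityʳ _ ⟨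
  ∣ p ∪ q ∣ + 0          ≡⟨ cong (∣ p ∪ q ∣ +_) (Empty⇒∣p∣≡0 disjoint) ⟨
  ∣ p ∪ q ∣ + ∣ p ∩ q ∣  ≡⟨ ∣p∪q∣+∣p∩q∣≡∣p∣+∣q∣ p q ⟩
  ∣ p ∣ + ∣ q ∣          ∎
  where open ≡-Reasoning

∣p∣+∣q─p∣≤∣q∣ : ∀ {p q : Subset n} → p ⊆ q → ∣ p ∣ + ∣ q ─ p ∣ ≤ ∣ q ∣
∣p∣+∣q─p∣≤∣q∣ {p = p} {q} p⊆q = begin
  ∣ p ∣ + ∣ q ─ p ∣  ≡⟨ ∣p∪q∣≡∣p∣+∣q∣ p (q ─ p) disjoint ⟨
  ∣ p ∪ (q ─ p) ∣    ≤⟨ p⊆q⇒∣p∣≤∣q∣ ⊆q ⟩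
  ∣ q ∣              ∎
  where
  open ≤-Reasoning
  disjoint : Empty (p ∩ (q ─ p))
  disjoint (x , x∈) = let x∈p , x∈q─p = x∈p∩q⁻ p (q ─ p) x∈ in x∈p─q⇒x∉q q p x∈q─p x∈p
  ⊆q : p ∪ (q ─ p) ⊆ q
  ⊆q x∈ with x∈p∪q⁻ p (q ─ p) x∈
  ... | inj₁ x∈p   = p⊆q x∈p
  ... | inj₂ x∈q─p = p─q⊆p q p x∈q─p

⊆⇒∣─∣≡0 : ∀ {p q : Subset n} → p ⊆ q → ∣ p ─ q ∣ ≡ 0
⊆⇒∣─∣≡0 {p = p} {q} p⊆q = Empty⇒∣p∣≡0 λ (x , x∈p─q) → x∈p─q⇒x∉q p q x∈p─q (p⊆q (p─q⊆p p q x∈p─q))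

∣p∣≤1+∣p-x∣ : ∀ (p : Subset n) x → ∣ p ∣ ≤ suc ∣ p - x ∣
∣p∣≤1+∣p-x∣ p x = begin
  ∣ p ∣                  ≤⟨ p⊆q⇒∣p∣≤∣q∣ (p⊆p-x∪⁅x⁆ p x) ⟩
  ∣ (p - x) ∪ ⁅ x ⁆ ∣    ≤⟨ ∣p∪q∣≤∣p∣+∣q∣ (p - x) ⁅ x ⁆ ⟩
  ∣ p - x ∣ + ∣ ⁅ x ⁆ ∣  ≡⟨ cong (∣ p - x ∣ +_) (∣⁅x⁆∣≡1 x) ⟩
  ∣ p - x ∣ + 1          ≡⟨ +-comm _ 1 ⟩
  suc ∣ p - x ∣          ∎
  where open ≤-Reasoning

x∈p⇒∣p∣≡1+∣p-x∣ : ∀ {p : Subset n} {x} → x ∈ p → ∣ p ∣ ≡ suc ∣ p - x ∣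
x∈p⇒∣p∣≡1+∣p-x∣ {p = p} {x} x∈p = ≤-antisym (∣p∣≤1+∣p-x∣ p x) (x∈p⇒∣p-x∣<∣p∣ x∈p)

x∉p⇒∣p∪⁅x⁆∣≡1+∣p∣ : ∀ {p : Subset n} {x} → x ∉ p → ∣ p ∪ ⁅ x ⁆ ∣ ≡ suc ∣ p ∣
x∉p⇒∣p∪⁅x⁆∣≡1+∣p∣ {p = p} {x} x∉p = ≤-antisym ≤1+∣p∣ (p⊂q⇒∣p∣<∣q∣ (p⊂p∪⁅x⁆ x∉p))
  where
  ≤1+∣p∣ : ∣ p ∪ ⁅ x ⁆ ∣ ≤ suc ∣ p ∣
  ≤1+∣p∣ = ≤-trans (∣p∪q∣≤∣p∣+∣q∣ p ⁅ x ⁆) (≤-reflexive (trans (cong (∣ p ∣ +_) (∣⁅x⁆∣≡1 x)) (+-comm _ 1)))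

Nonempty-∣∣ : ∀ {p : Subset m} {q : Subset n} → ∣ p ∣ ≡ ∣ q ∣ → Nonempty p → Nonempty q
Nonempty-∣∣ {q = q} ∣p∣≡∣q∣ (x , x∈p) with nonempty? q
... | yes nonempty = nonempty
... | no empty     = contradiction (trans ∣p∣≡∣q∣ (Empty⇒∣p∣≡0 empty)) (m<n⇒n≢0 (x∈p⇒∣p-x∣<∣p∣ x∈p))

∣∷∣-cancel : ∀ x {p q : Subset n} → ∣ x ∷ p ∣ ≡ ∣ x ∷ q ∣ → ∣ p ∣ ≡ ∣ q ∣
∣∷∣-cancel inside  = suc-injective
∣∷∣-cancel outside = id

∣∷∣-cong : ∀ x {p : Subset m} {q : Subset n} → ∣ p ∣ ≡ ∣ q ∣ → ∣ x ∷ p ∣ ≡ ∣ x ∷ q ∣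
∣∷∣-cong inside  = cong suc
∣∷∣-cong outside = id

∣∷∷∣-swap : ∀ x y (p : Subset n) → ∣ x ∷ y ∷ p ∣ ≡ ∣ y ∷ x ∷ p ∣
∣∷∷∣-swap inside  inside  p = refl
∣∷∷∣-swap inside  outside p = refl
∣∷∷∣-swap outside inside  p = refl
∣∷∷∣-swap outside outside p = refl

∣tabulate∣-punchIn : ∀ (f : Fin (suc n) → Bool) j → ∣ tabulate f ∣ ≡ ∣ f j ∷ tabulate (f ∘ punchIn j) ∣
∣tabulate∣-punchIn f zero = refl
∣tabulate∣-punchIn {suc n} f (suc j) =
  trans (∣∷∣-cong (f zero) {tabulate (f ∘ suc)} {f (suc j) ∷ rest} (∣tabulate∣-punchIn (f ∘ suc) j))
        (∣∷∷∣-swap (f zero) (f (suc j)) rest)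
  where
  rest : Subset n
  rest = tabulate (f ∘ suc ∘ punchIn j)

module _ (f : Fin m → Fin n) where

  lookup-S : ∀ X i → lookup (S[ f ] X) i ≡ lookup X (f i)
  lookup-S X i = lookup∘tabulate _ i

  ∈S⁺ : ∀ {X i} → f i ∈ X → i ∈ S[ f ] X
  ∈S⁺ {X} {i} fi∈X = lookup⇒[]= i (S[ f ] X) (trans (lookup-S X i) ([]=⇒lookup fi∈X))

  ∈S⁻ : ∀ {X i} → i ∈ S[ f ] X → f i ∈ X
  ∈S⁻ {X} {i} i∈SX = lookup⇒[]= (f i) X (trans (sym (lookup-S X i)) ([]=⇒lookup i∈SX))

  S-mono : ∀ {X Y} → X ⊆ Y → S[ f ] X ⊆ S[ f ] Y
  S-mono X⊆Y = ∈S⁺ ∘ X⊆Y ∘ ∈S⁻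

  S-zipWith : ∀ (_∙_ : Bool → Bool → Bool) X Y → S[ f ] (zipWith _∙_ X Y) ≡ zipWith _∙_ (S[ f ] X) (S[ f ] Y)
  S-zipWith _∙_ X Y = pointwise λ i → begin
    lookup (S[ f ] (zipWith _∙_ X Y)) i             ≡⟨ lookup-S (zipWith _∙_ X Y) i ⟩
    lookup (zipWith _∙_ X Y) (f i)                  ≡⟨ lookup-zipWith _∙_ (f i) X Y ⟩
    lookup X (f i) ∙ lookup Y (f i)                 ≡⟨ cong₂ _∙_ (lookup-S X i) (lookup-S Y i) ⟨
    lookup (S[ f ] X) i ∙ lookup (S[ f ] Y) i       ≡⟨ lookup-zipWith _∙_ i (S[ f ] X) (S[ f ] Y) ⟨
    lookup (zipWith _∙_ (S[ f ] X) (S[ f ] Y)) i    ∎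
    where open ≡-Reasoning

  S-∪ : ∀ X Y → S[ f ] (X ∪ Y) ≡ S[ f ] X ∪ S[ f ] Y
  S-∪ = S-zipWith _

  S-∩ : ∀ X Y → S[ f ] (X ∩ Y) ≡ S[ f ] X ∩ S[ f ] Y
  S-∩ = S-zipWith _

  S-∁ : ∀ X → S[ f ] (∁ X) ≡ ∁ (S[ f ] X)
  S-∁ X = pointwise λ i → begin
    lookup (S[ f ] (∁ X)) i      ≡⟨ lookup-S (∁ X) i ⟩
    lookup (∁ X) (f i)           ≡⟨ lookup-map (f i) not X ⟩
    not (lookup X (f i))         ≡⟨ cong not (lookup-S X i) ⟨
    not (lookup (S[ f ] X) i)    ≡⟨ lookup-map i not (S[ f ] X) ⟨
    lookup (∁ (S[ f ] X)) i      ∎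
    where open ≡-Reasoning

  S-─ : ∀ X Y → S[ f ] (X ─ Y) ≡ S[ f ] X ─ S[ f ] Y
  S-─ X Y = begin
    S[ f ] (X ─ Y)              ≡⟨ cong S[ f ] (─≡∩∁ X Y) ⟩
    S[ f ] (X ∩ ∁ Y)            ≡⟨ S-∩ X (∁ Y) ⟩
    S[ f ] X ∩ S[ f ] (∁ Y)     ≡⟨ cong (S[ f ] X ∩_) (S-∁ Y) ⟩
    S[ f ] X ∩ ∁ (S[ f ] Y)     ≡⟨ ─≡∩∁ (S[ f ] X) (S[ f ] Y) ⟨
    S[ f ] X ─ S[ f ] Y         ∎
    where open ≡-Reasoning

  S-⊤ : S[ f ] ⊤ ≡ ⊤
  S-⊤ = pointwise λ i → trans (lookup-S ⊤ i) (trans (lookup-replicate (f i) true) (sym (lookup-replicate i true)))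

S-∘ : ∀ (f : Fin k → Fin m) (g : Fin m → Fin n) X → S[ f ] (S[ g ] X) ≡ S[ g ∘ f ] X
S-∘ f g X = pointwise λ i → trans (lookup-S f (S[ g ] X) i) (trans (lookup-S g X (f i)) (sym (lookup-S (g ∘ f) X i)))

S-cong : ∀ {f g : Fin m → Fin n} → (∀ i → f i ≡ g i) → ∀ X → S[ f ] X ≡ S[ g ] X
S-cong f≗g X = tabulate-cong (cong (lookup X) ∘ f≗g)

S-inverse : ∀ (f : Fin m → Fin n) (g : Fin n → Fin m) → (∀ i → g (f i) ≡ i) → ∀ X → S[ f ] (S[ g ] X) ≡ X
S-inverse f g g∘f≗id X = begin
  S[ f ] (S[ g ] X)    ≡⟨ S-∘ f g X ⟩
  S[ g ∘ f ] X         ≡⟨ S-cong g∘f≗id X ⟩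
  tabulate (lookup X)  ≡⟨ tabulate∘lookup X ⟩
  X                    ∎
  where open ≡-Reasoning

S[π⁻¹]∘S[π] : ∀ (π : Permutation′ n) X → S[ π ⟨$⟩ˡ_ ] (S[ π ⟨$⟩ʳ_ ] X) ≡ X
S[π⁻¹]∘S[π] π = S-inverse (π ⟨$⟩ˡ_) (π ⟨$⟩ʳ_) (λ _ → inverseʳ π)

S[π]∘S[π⁻¹] : ∀ (π : Permutation′ n) X → S[ π ⟨$⟩ʳ_ ] (S[ π ⟨$⟩ˡ_ ] X) ≡ X
S[π]∘S[π⁻¹] π = S-inverse (π ⟨$⟩ʳ_) (π ⟨$⟩ˡ_) (λ _ → inverseˡ π)

S-⁅⁆ : ∀ (π : Permutation′ n) e → S[ π ⟨$⟩ʳ_ ] ⁅ e ⁆ ≡ ⁅ π ⟨$⟩ˡ e ⁆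
S-⁅⁆ π e = ⊆-antisym ⊆⁅π⁻¹e⁆ ⁅π⁻¹e⁆⊆
  where
  ⊆⁅π⁻¹e⁆ : S[ π ⟨$⟩ʳ_ ] ⁅ e ⁆ ⊆ ⁅ π ⟨$⟩ˡ e ⁆
  ⊆⁅π⁻¹e⁆ {i} i∈ with x∈⁅y⁆⇒x≡y e (∈S⁻ (π ⟨$⟩ʳ_) i∈)
  ... | refl = subst (_∈ ⁅ π ⟨$⟩ˡ (π ⟨$⟩ʳ i) ⁆) (inverseˡ π) (x∈⁅x⁆ _)
  ⁅π⁻¹e⁆⊆ : ⁅ π ⟨$⟩ˡ e ⁆ ⊆ S[ π ⟨$⟩ʳ_ ] ⁅ e ⁆
  ⁅π⁻¹e⁆⊆ i∈ with x∈⁅y⁆⇒x≡y _ i∈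
  ... | refl = ∈S⁺ (π ⟨$⟩ʳ_) (subst (_∈ ⁅ e ⁆) (sym (inverseʳ π)) (x∈⁅x⁆ e))

module _ {t} {p : Fin m → Fin n} (blocks : BlocksOfSize p t) where

  ∣S∣≡t*∣∣ : ∀ X → ∣ S[ p ] X ∣ ≡ t * ∣ X ∣
  ∣S∣≡t*∣∣ X = go X (⊂-wellFounded X)
    where
    go : ∀ X → Acc _⊂_ X → ∣ S[ p ] X ∣ ≡ t * ∣ X ∣
    go X (acc rec) with nonempty? X
    ... | no empty = begin
      ∣ S[ p ] X ∣  ≡⟨ Empty⇒∣p∣≡0 (λ (i , i∈) → empty (p i , ∈S⁻ p i∈)) ⟩
      0             ≡⟨ *-zeroʳ t ⟨
      t * 0         ≡⟨ cong (t *_) (Empty⇒∣p∣≡0 empty) ⟨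
      t * ∣ X ∣     ∎
      where open ≡-Reasoning
    ... | yes (e , e∈X) = begin
      ∣ S[ p ] X ∣                             ≡⟨ cong (∣_∣ ∘ S[ p ]) (p-x∪⁅x⁆≡p e∈X) ⟨
      ∣ S[ p ] ((X - e) ∪ ⁅ e ⁆) ∣             ≡⟨ cong ∣_∣ (S-∪ p (X - e) ⁅ e ⁆) ⟩
      ∣ S[ p ] (X - e) ∪ S[ p ] ⁅ e ⁆ ∣        ≡⟨ ∣p∪q∣≡∣p∣+∣q∣ _ _ disjoint ⟩
      ∣ S[ p ] (X - e) ∣ + ∣ S[ p ] ⁅ e ⁆ ∣    ≡⟨ cong₂ _+_ (go (X - e) (rec (x∈p⇒p-x⊂p e∈X))) (blocks e) ⟩
      t * ∣ X - e ∣ + t                        ≡⟨ +-comm _ t ⟩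
      t + t * ∣ X - e ∣                        ≡⟨ *-suc t _ ⟨
      t * suc ∣ X - e ∣                        ≡⟨ cong (t *_) (x∈p⇒∣p∣≡1+∣p-x∣ e∈X) ⟨
      t * ∣ X ∣                                ∎
      where
      open ≡-Reasoning
      disjoint : Empty (S[ p ] (X - e) ∩ S[ p ] ⁅ e ⁆)
      disjoint (i , i∈) = let i∈S[X-e] , i∈S⁅e⁆ = x∈p∩q⁻ _ _ i∈ in
        x∈p─q⇒x∉q X ⁅ e ⁆ (∈S⁻ p i∈S[X-e]) (∈S⁻ p i∈S⁅e⁆)

permutation-blocks : ∀ (π : Permutation′ n) → BlocksOfSize (π ⟨$⟩ʳ_) 1
permutation-blocks π e = trans (cong ∣_∣ (S-⁅⁆ π e)) (∣⁅x⁆∣≡1 (π ⟨$⟩ˡ e))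

∣S[π]∣≡∣∣ : ∀ (π : Permutation′ n) X → ∣ S[ π ⟨$⟩ʳ_ ] X ∣ ≡ ∣ X ∣
∣S[π]∣≡∣∣ π X = trans (∣S∣≡t*∣∣ {p = π ⟨$⟩ʳ_} (permutation-blocks π) X) (*-identityˡ _)

blocks-∘ : ∀ {t} {p : Fin m → Fin n} (π : Permutation′ n) → BlocksOfSize p t → BlocksOfSize ((π ⟨$⟩ʳ_) ∘ p) t
blocks-∘ {p = p} π blocks e = trans (cong ∣_∣ (sym (S-∘ p (π ⟨$⟩ʳ_) ⁅ e ⁆))) (trans (cong (∣_∣ ∘ S[ p ]) (S-⁅⁆ π e)) (blocks (π ⟨$⟩ˡ e)))

-- Cyclic flats determine the rank function

module _ (M : Matroid n) where

  private
    r : Subset n → ℕ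
    r = rank M

  rank-∪-≤ : ∀ X Y → r (X ∪ Y) ≤ r X + ∣ Y ∣
  rank-∪-≤ X Y = begin
    r (X ∪ Y)              ≤⟨ m≤m+n _ _ ⟩
    r (X ∪ Y) + r (X ∩ Y)  ≤⟨ rank-submod M X Y ⟩
    r X + r Y              ≤⟨ +-monoʳ-≤ (r X) (rank-≤-card M Y) ⟩
    r X + ∣ Y ∣            ∎
    where open ≤-Reasoning

  rank-≤-rank+∣─∣ : ∀ X Z → r X ≤ r Z + ∣ X ─ Z ∣
  rank-≤-rank+∣─∣ X Z = ≤-trans (rank-mono M X⊆Z∪X─Z) (rank-∪-≤ Z (X ─ Z))
    where
    X⊆Z∪X─Z : X ⊆ Z ∪ (X ─ Z)
    X⊆Z∪X─Z {x} x∈X with x ∈? Z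
    ... | yes x∈Z = p⊆p∪q (X ─ Z) x∈Z
    ... | no  x∉Z = q⊆p∪q Z (X ─ Z) (x∈p∧x∉q⇒x∈p─q x∈X x∉Z)

  flat-or-extendable : ∀ X → IsFlat r X ⊎ ∃ λ e → e ∉ X × r (X ∪ ⁅ e ⁆) ≤ r X
  flat-or-extendable X with any? (λ e → ¬? (e ∈? X) ×-dec (r (X ∪ ⁅ e ⁆) ≤? r X))
  ... | yes extendable = inj₂ extendable
  ... | no ¬extendable = inj₁ λ e e∉X → ≰⇒> λ ≤rX → ¬extendable (e , e∉X , ≤rX)

  noColoops-or-coloop : ∀ X → NoColoops r X ⊎ ∃ λ c → c ∈ X × r (X - c) < r X
  noColoops-or-coloop X with any? (λ c → (c ∈? X) ×-dec (r (X - c) <? r X))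
  ... | yes coloop = inj₂ coloop
  ... | no ¬coloop = inj₁ λ c c∈X →
    ≤-antisym (rank-mono M (p─q⊆p X ⁅ c ⁆)) (≮⇒≥ λ <rX → ¬coloop (c , c∈X , <rX))

  noColoops-∪⁅⁆ : ∀ {X e} → NoColoops r X → e ∉ X → r (X ∪ ⁅ e ⁆) ≤ r X → NoColoops r (X ∪ ⁅ e ⁆)
  noColoops-∪⁅⁆ {X} {e} noColoops e∉X ≤rX x x∈ =
    ≤-antisym (rank-mono M (p─q⊆p (X ∪ ⁅ e ⁆) ⁅ x ⁆)) (≤-trans ≤rX rX≤)
    where
    rX≤ : r X ≤ r ((X ∪ ⁅ e ⁆) - x)
    rX≤ with x∈p∪q⁻ X ⁅ e ⁆ x∈
    ... | inj₁ x∈X = begin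
      r X                   ≡⟨ noColoops x x∈X ⟨
      r (X - x)             ≤⟨ rank-mono M (─-monoˡ-⊆ ⁅ x ⁆ (p⊆p∪q ⁅ e ⁆)) ⟩
      r ((X ∪ ⁅ e ⁆) - x)   ∎
      where open ≤-Reasoning
    ... | inj₂ x∈⁅e⁆ with x∈⁅y⁆⇒x≡y e x∈⁅e⁆
    ...   | refl = rank-mono M (p⊆p∪⁅x⁆-x e∉X)

  noColoops⇒⊆cyclicFlat : ∀ X → NoColoops r X → ∃ λ Z → IsCyclicFlat r Z × X ⊆ Z × r Z ≤ r X
  noColoops⇒⊆cyclicFlat X = go X (⊃-wellFounded X)
    where
    go : ∀ X → Acc _⊃_ X → NoColoops r X → ∃ λ Z → IsCyclicFlat r Z × X ⊆ Z × r Z ≤ r X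
    go X (acc rec) noColoops with flat-or-extendable X
    ... | inj₁ flat = X , (flat , noColoops) , ⊆-refl , ≤-refl
    ... | inj₂ (e , e∉X , ≤rX) with go (X ∪ ⁅ e ⁆) (rec (p⊂p∪⁅x⁆ e∉X)) (noColoops-∪⁅⁆ noColoops e∉X ≤rX)
    ...   | Z , cyclicFlat , ⊆Z , rZ≤ = Z , cyclicFlat , ⊆-trans (p⊆p∪q ⁅ e ⁆) ⊆Z , ≤-trans rZ≤ ≤rX

  cyclicFlat-bound : ∀ X → ∃ λ Z → IsCyclicFlat r Z × r Z + ∣ X ─ Z ∣ ≤ r X
  cyclicFlat-bound X = go X (⊂-wellFounded X)
    where
    go : ∀ X → Acc _⊂_ X → ∃ λ Z → IsCyclicFlat r Z × r Z + ∣ X ─ Z ∣ ≤ r X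
    go X (acc rec) with noColoops-or-coloop X
    ... | inj₁ noColoops with noColoops⇒⊆cyclicFlat X noColoops
    ...   | Z , cyclicFlat , X⊆Z , rZ≤ = Z , cyclicFlat , (begin
      r Z + ∣ X ─ Z ∣  ≡⟨ cong (r Z +_) (⊆⇒∣─∣≡0 X⊆Z) ⟩
      r Z + 0          ≡⟨ +-identityʳ (r Z) ⟩
      r Z              ≤⟨ rZ≤ ⟩
      r X              ∎)
      where open ≤-Reasoning
    go X (acc rec) | inj₂ (c , c∈X , <rX) with go (X - c) (rec (x∈p⇒p-x⊂p c∈X))
    ...   | Z , cyclicFlat , bound = Z , cyclicFlat , (begin
      r Z + ∣ X ─ Z ∣               ≤⟨ +-monoʳ-≤ (r Z) (∣p∣≤1+∣p-x∣ (X ─ Z) c) ⟩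
      r Z + suc ∣ X ─ Z - c ∣       ≡⟨ cong (λ W → r Z + suc ∣ W ∣) (p─q─r≡p─r─q X Z ⁅ c ⁆) ⟩
      r Z + suc ∣ (X - c) ─ Z ∣     ≡⟨ +-suc (r Z) _ ⟩
      suc (r Z + ∣ (X - c) ─ Z ∣)   ≤⟨ s≤s bound ⟩
      suc (r (X - c))               ≤⟨ <rX ⟩
      r X                           ∎)
      where open ≤-Reasoning

rank-≤-of-cyclicFlats : ∀ (A B : Matroid n) → (∀ Z → IsCyclicFlat (rank B) Z → rank A Z ≤ rank B Z) →
                        ∀ X → rank A X ≤ rank B X
rank-≤-of-cyclicFlats A B ≤B X with cyclicFlat-bound B X
... | Z , cyclicFlat , bound = begin
  rank A X                ≤⟨ rank-≤-rank+∣─∣ A X Z ⟩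
  rank A Z + ∣ X ─ Z ∣    ≤⟨ +-monoˡ-≤ ∣ X ─ Z ∣ (≤B Z cyclicFlat) ⟩
  rank B Z + ∣ X ─ Z ∣    ≤⟨ bound ⟩
  rank B X                ∎
  where open ≤-Reasoning

-- The dual matroid

∸-pair-mono-≤ : ∀ {a b c d k} → k ≤ a → k ≤ b → a + b ≤ c + d → (a ∸ k) + (b ∸ k) ≤ (c ∸ k) + (d ∸ k)
∸-pair-mono-≤ {a} {b} {c} {d} {k} k≤a k≤b ab≤cd = +-cancelˡ-≤ (k + k) _ _ (begin
  (k + k) + ((a ∸ k) + (b ∸ k))  ≡⟨ interchange +-commutativeSemigroup k k (a ∸ k) (b ∸ k) ⟩
  (k + (a ∸ k)) + (k + (b ∸ k))  ≡⟨ cong₂ _+_ (m+[n∸m]≡n k≤a) (m+[n∸m]≡n k≤b) ⟩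
  a + b                          ≤⟨ ab≤cd ⟩
  c + d                          ≤⟨ +-mono-≤ (m≤n+m∸n c k) (m≤n+m∸n d k) ⟩
  (k + (c ∸ k)) + (k + (d ∸ k))  ≡⟨ interchange +-commutativeSemigroup k k (c ∸ k) (d ∸ k) ⟨
  (k + k) + ((c ∸ k) + (d ∸ k))  ∎)
  where open ≤-Reasoning

m∸o<n∸o⇒m<n : ∀ {m n o} → m ∸ o < n ∸ o → m < n
m∸o<n∸o⇒m<n {m} {n} {o} m∸o<n∸o = ≰⇒> λ n≤m → <⇒≱ m∸o<n∸o (∸-monoˡ-≤ o n≤m)

module _ (M : Matroid n) where

  private
    r : Subset n → ℕ
    r = rank M

  shiftedDualRank : Subset n → ℕ
  shiftedDualRank X = ∣ X ∣ + r (∁ X)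

  -- dualRank M X is shiftedDualRank X ∸ r ⊤; this bound makes the truncated subtraction exact.
  rank⊤≤shiftedDualRank : ∀ X → r ⊤ ≤ shiftedDualRank X
  rank⊤≤shiftedDualRank X = begin
    r ⊤                ≡⟨ cong r (∪-inverseˡ X) ⟨
    r (∁ X ∪ X)        ≤⟨ rank-∪-≤ M (∁ X) X ⟩
    r (∁ X) + ∣ X ∣    ≡⟨ +-comm (r (∁ X)) ∣ X ∣ ⟩
    shiftedDualRank X  ∎
    where open ≤-Reasoning

  dualRank-≤-card : ∀ X → dualRank M X ≤ ∣ X ∣
  dualRank-≤-card X = m≤n+o⇒m∸n≤o (shiftedDualRank X) (r ⊤) (begin
    ∣ X ∣ + r (∁ X)  ≤⟨ +-monoʳ-≤ ∣ X ∣ (rank-mono M ⊆⊤) ⟩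
    ∣ X ∣ + r ⊤      ≡⟨ +-comm ∣ X ∣ (r ⊤) ⟩
    r ⊤ + ∣ X ∣      ∎)
    where open ≤-Reasoning

  shiftedDualRank-mono : ∀ {X Y} → X ⊆ Y → shiftedDualRank X ≤ shiftedDualRank Y
  shiftedDualRank-mono {X} {Y} X⊆Y = begin
    ∣ X ∣ + r (∁ X)                    ≤⟨ +-monoʳ-≤ ∣ X ∣ (rank-≤-rank+∣─∣ M (∁ X) (∁ Y)) ⟩
    ∣ X ∣ + (r (∁ Y) + ∣ ∁ X ─ ∁ Y ∣)  ≤⟨ +-monoʳ-≤ ∣ X ∣ (+-monoʳ-≤ (r (∁ Y)) (p⊆q⇒∣p∣≤∣q∣ ∁X─∁Y⊆Y─X)) ⟩
    ∣ X ∣ + (r (∁ Y) + ∣ Y ─ X ∣)      ≡⟨ cong (∣ X ∣ +_) (+-comm (r (∁ Y)) (∣ Y ─ X ∣)) ⟩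
    ∣ X ∣ + (∣ Y ─ X ∣ + r (∁ Y))      ≡⟨ +-assoc (∣ X ∣) (∣ Y ─ X ∣) (r (∁ Y)) ⟨
    (∣ X ∣ + ∣ Y ─ X ∣) + r (∁ Y)      ≤⟨ +-monoˡ-≤ (r (∁ Y)) (∣p∣+∣q─p∣≤∣q∣ X⊆Y) ⟩
    ∣ Y ∣ + r (∁ Y)                    ∎
    where
    open ≤-Reasoning
    ∁X─∁Y⊆Y─X : ∁ X ─ ∁ Y ⊆ Y ─ X
    ∁X─∁Y⊆Y─X x∈ = x∈p∧x∉q⇒x∈p─q (x∉∁p⇒x∈p (x∈p─q⇒x∉q (∁ X) (∁ Y) x∈)) (x∈∁p⇒x∉p (p─q⊆p (∁ X) (∁ Y) x∈))

  dualRank-mono : ∀ {X Y} → X ⊆ Y → dualRank M X ≤ dualRank M Y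
  dualRank-mono X⊆Y = ∸-monoˡ-≤ (r ⊤) (shiftedDualRank-mono X⊆Y)

  dualRank-submod : ∀ X Y → dualRank M (X ∪ Y) + dualRank M (X ∩ Y) ≤ dualRank M X + dualRank M Y
  dualRank-submod X Y = ∸-pair-mono-≤ (rank⊤≤shiftedDualRank (X ∪ Y)) (rank⊤≤shiftedDualRank (X ∩ Y)) (begin
    (∣ X ∪ Y ∣ + r (∁ (X ∪ Y))) + (∣ X ∩ Y ∣ + r (∁ (X ∩ Y)))
      ≡⟨ interchange +-commutativeSemigroup (∣ X ∪ Y ∣) _ (∣ X ∩ Y ∣) _ ⟩
    (∣ X ∪ Y ∣ + ∣ X ∩ Y ∣) + (r (∁ (X ∪ Y)) + r (∁ (X ∩ Y)))
      ≡⟨ cong₂ _+_ (∣p∪q∣+∣p∩q∣≡∣p∣+∣q∣ X Y) (cong₂ (λ U V → r U + r V) (SubsetBA.deMorgan₂ X Y) (SubsetBA.deMorgan₁ X Y)) ⟩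
    (∣ X ∣ + ∣ Y ∣) + (r (∁ X ∩ ∁ Y) + r (∁ X ∪ ∁ Y))
      ≤⟨ +-monoʳ-≤ (∣ X ∣ + ∣ Y ∣) (≤-trans (≤-reflexive (+-comm (r (∁ X ∩ ∁ Y)) _)) (rank-submod M (∁ X) (∁ Y))) ⟩
    (∣ X ∣ + ∣ Y ∣) + (r (∁ X) + r (∁ Y))
      ≡⟨ interchange +-commutativeSemigroup (∣ X ∣) (∣ Y ∣) _ _ ⟩
    shiftedDualRank X + shiftedDualRank Y
      ∎)
    where open ≤-Reasoning

  shiftedDualRank-∪⁅⁆ : ∀ {Z e} → e ∉ Z → shiftedDualRank (Z ∪ ⁅ e ⁆) ≡ suc (∣ Z ∣ + r (∁ Z - e))
  shiftedDualRank-∪⁅⁆ {Z} {e} e∉Z = cong₂ _+_ (x∉p⇒∣p∪⁅x⁆∣≡1+∣p∣ e∉Z) (cong r (∁-∪ Z ⁅ e ⁆))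

  shiftedDualRank-- : ∀ {Z e} → e ∈ Z → suc (shiftedDualRank (Z - e)) ≡ ∣ Z ∣ + r (∁ Z ∪ ⁅ e ⁆)
  shiftedDualRank-- {Z} {e} e∈Z = cong₂ _+_ (sym (x∈p⇒∣p∣≡1+∣p-x∣ e∈Z)) (cong r (∁-─ Z ⁅ e ⁆))

  dualRank-jumps⇔notColoop-∁ : ∀ {Z e} → e ∉ Z → dualRank M Z < dualRank M (Z ∪ ⁅ e ⁆) ⇔ r (∁ Z - e) ≡ r (∁ Z)
  dualRank-jumps⇔notColoop-∁ {Z} {e} e∉Z = mk⇔ to from
    where
    to : dualRank M Z < dualRank M (Z ∪ ⁅ e ⁆) → r (∁ Z - e) ≡ r (∁ Z)
    to jumps = ≤-antisym (rank-mono M (p─q⊆p (∁ Z) ⁅ e ⁆)) (+-cancelˡ-≤ ∣ Z ∣ _ _ (s≤s⁻¹ (begin-strict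
      shiftedDualRank Z             <⟨ m∸o<n∸o⇒m<n {o = r ⊤} jumps ⟩
      shiftedDualRank (Z ∪ ⁅ e ⁆)   ≡⟨ shiftedDualRank-∪⁅⁆ e∉Z ⟩
      suc (∣ Z ∣ + r (∁ Z - e))     ∎)))
      where open ≤-Reasoning
    from : r (∁ Z - e) ≡ r (∁ Z) → dualRank M Z < dualRank M (Z ∪ ⁅ e ⁆)
    from notColoop = ∸-monoˡ-< (≤-reflexive (sym (begin
      shiftedDualRank (Z ∪ ⁅ e ⁆)   ≡⟨ shiftedDualRank-∪⁅⁆ e∉Z ⟩
      suc (∣ Z ∣ + r (∁ Z - e))     ≡⟨ cong (λ x → suc (∣ Z ∣ + x)) notColoop ⟩
      suc (shiftedDualRank Z)       ∎))) (rank⊤≤shiftedDualRank Z)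
      where open ≡-Reasoning

  dualRank-notColoop⇔jumps-∁ : ∀ {Z e} → e ∈ Z → dualRank M (Z - e) ≡ dualRank M Z ⇔ r (∁ Z) < r (∁ Z ∪ ⁅ e ⁆)
  dualRank-notColoop⇔jumps-∁ {Z} {e} e∈Z = mk⇔ to from
    where
    to : dualRank M (Z - e) ≡ dualRank M Z → r (∁ Z) < r (∁ Z ∪ ⁅ e ⁆)
    to notColoop = ≤-reflexive (sym (+-cancelˡ-≡ ∣ Z ∣ _ _ (begin
      ∣ Z ∣ + r (∁ Z ∪ ⁅ e ⁆)       ≡⟨ shiftedDualRank-- e∈Z ⟨
      suc (shiftedDualRank (Z - e)) ≡⟨ cong suc (∸-cancelʳ-≡ (rank⊤≤shiftedDualRank (Z - e)) (rank⊤≤shiftedDualRank Z) notColoop) ⟩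
      suc (shiftedDualRank Z)       ≡⟨ +-suc ∣ Z ∣ (r (∁ Z)) ⟨
      ∣ Z ∣ + suc (r (∁ Z))         ∎)))
      where open ≡-Reasoning
    from : r (∁ Z) < r (∁ Z ∪ ⁅ e ⁆) → dualRank M (Z - e) ≡ dualRank M Z
    from jumps = cong (_∸ r ⊤) (suc-injective (begin
      suc (shiftedDualRank (Z - e)) ≡⟨ shiftedDualRank-- e∈Z ⟩
      ∣ Z ∣ + r (∁ Z ∪ ⁅ e ⁆)       ≡⟨ cong (∣ Z ∣ +_) (≤-antisym ≤1+r∁Z jumps) ⟩
      ∣ Z ∣ + suc (r (∁ Z))         ≡⟨ +-suc ∣ Z ∣ (r (∁ Z)) ⟩
      suc (shiftedDualRank Z)       ∎))
      where
      open ≡-Reasoning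
      ≤1+r∁Z : r (∁ Z ∪ ⁅ e ⁆) ≤ suc (r (∁ Z))
      ≤1+r∁Z = ≤-trans (rank-∪-≤ M (∁ Z) ⁅ e ⁆) (≤-reflexive (trans (cong (r (∁ Z) +_) (∣⁅x⁆∣≡1 e)) (+-comm _ 1)))

  isCyclicFlat-dual⇒∁ : ∀ {Z} → IsCyclicFlat (dualRank M) Z → IsCyclicFlat r (∁ Z)
  isCyclicFlat-dual⇒∁ (flat , noColoops) =
    (λ e e∉∁Z → let e∈Z = x∉∁p⇒x∈p e∉∁Z in Equivalence.to (dualRank-notColoop⇔jumps-∁ e∈Z) (noColoops e e∈Z)) ,
    (λ e e∈∁Z → let e∉Z = x∈∁p⇒x∉p e∈∁Z in Equivalence.to (dualRank-jumps⇔notColoop-∁ e∉Z) (flat e e∉Z))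

  isCyclicFlat-∁⇒dual : ∀ {Z} → IsCyclicFlat r (∁ Z) → IsCyclicFlat (dualRank M) Z
  isCyclicFlat-∁⇒dual (flat , noColoops) =
    (λ e e∉Z → Equivalence.from (dualRank-jumps⇔notColoop-∁ e∉Z) (noColoops e (x∉p⇒x∈∁p e∉Z))) ,
    (λ e e∈Z → Equivalence.from (dualRank-notColoop⇔jumps-∁ e∈Z) (flat e (x∈p⇒x∉∁p e∈Z)))

dual : Matroid n → Matroid n
dual M = record
  { rank        = dualRank M
  ; rank-≤-card = dualRank-≤-card M
  ; rank-mono   = dualRank-mono M
  ; rank-submod = dualRank-submod M
  }

-- Expansions

module _ {t} {p : Fin m → Fin n} (blocks : BlocksOfSize p t) (M : Matroid n) (Mt : Matroid m)
         (expansion : IsExpansion p t (rank M) (rank Mt)) where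

  private
    cyclicFlat⇒S : ∀ Z → IsCyclicFlat (rank Mt) Z → ∃ λ A → IsCyclicFlat (rank M) A × Z ≡ S[ p ] A
    cyclicFlat⇒S = proj₁ expansion
    S-cyclicFlat : ∀ A → IsCyclicFlat (rank M) A → IsCyclicFlat (rank Mt) (S[ p ] A)
    S-cyclicFlat = proj₁ (proj₂ expansion)
    rank-S : ∀ A → IsCyclicFlat (rank M) A → rank Mt (S[ p ] A) ≡ t * rank M A
    rank-S = proj₂ (proj₂ expansion)

  ∣S─S∣≡t*∣─∣ : ∀ X Y → ∣ S[ p ] X ─ S[ p ] Y ∣ ≡ t * ∣ X ─ Y ∣
  ∣S─S∣≡t*∣─∣ X Y = trans (cong ∣_∣ (sym (S-─ p X Y))) (∣S∣≡t*∣∣ {p = p} blocks (X ─ Y))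

  expansion-rank : ∀ X → rank Mt (S[ p ] X) ≡ t * rank M X
  expansion-rank X = ≤-antisym upper lower
    where
    open ≤-Reasoning
    upper : rank Mt (S[ p ] X) ≤ t * rank M X
    upper with cyclicFlat-bound M X
    ... | Z , cyclicFlat , bound = begin
      rank Mt (S[ p ] X)                            ≤⟨ rank-≤-rank+∣─∣ Mt (S[ p ] X) (S[ p ] Z) ⟩
      rank Mt (S[ p ] Z) + ∣ S[ p ] X ─ S[ p ] Z ∣  ≡⟨ cong₂ _+_ (rank-S Z cyclicFlat) (∣S─S∣≡t*∣─∣ X Z) ⟩
      t * rank M Z + t * ∣ X ─ Z ∣                  ≡⟨ *-distribˡ-+ t _ _ ⟨
      t * (rank M Z + ∣ X ─ Z ∣)                    ≤⟨ *-monoʳ-≤ t bound ⟩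
      t * rank M X                                  ∎
    lower : t * rank M X ≤ rank Mt (S[ p ] X)
    lower with cyclicFlat-bound Mt (S[ p ] X)
    ... | W , cyclicFlat , bound with cyclicFlat⇒S W cyclicFlat
    ...   | A , cyclicFlatA , refl = begin
      t * rank M X                                  ≤⟨ *-monoʳ-≤ t (rank-≤-rank+∣─∣ M X A) ⟩
      t * (rank M A + ∣ X ─ A ∣)                    ≡⟨ *-distribˡ-+ t _ _ ⟩
      t * rank M A + t * ∣ X ─ A ∣                  ≡⟨ cong₂ _+_ (rank-S A cyclicFlatA) (∣S─S∣≡t*∣─∣ X A) ⟨
      rank Mt (S[ p ] A) + ∣ S[ p ] X ─ S[ p ] A ∣  ≤⟨ bound ⟩
      rank Mt (S[ p ] X)                            ∎

  dualRank-S : ∀ X → dualRank Mt (S[ p ] X) ≡ t * dualRank M X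
  dualRank-S X = begin
    (∣ S[ p ] X ∣ + rank Mt (∁ (S[ p ] X))) ∸ rank Mt ⊤  ≡⟨ cong₂ _∸_ (cong₂ _+_ (∣S∣≡t*∣∣ {p = p} blocks X) rank-∁) rank-⊤ ⟩
    (t * ∣ X ∣ + t * rank M (∁ X)) ∸ t * rank M ⊤        ≡⟨ cong (_∸ t * rank M ⊤) (*-distribˡ-+ t _ _) ⟨
    t * (∣ X ∣ + rank M (∁ X)) ∸ t * rank M ⊤            ≡⟨ *-distribˡ-∸ t _ _ ⟨
    t * dualRank M X                                     ∎
    where
    open ≡-Reasoning
    rank-∁ : rank Mt (∁ (S[ p ] X)) ≡ t * rank M (∁ X)
    rank-∁ = trans (cong (rank Mt) (sym (S-∁ p X))) (expansion-rank (∁ X))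
    rank-⊤ : rank Mt ⊤ ≡ t * rank M ⊤
    rank-⊤ = trans (cong (rank Mt) (sym (S-⊤ p))) (expansion-rank ⊤)

  expansion-dual : IsExpansion p t (dualRank M) (dualRank Mt)
  expansion-dual = cyclicFlat⇒S* , S-cyclicFlat* , λ A _ → dualRank-S A
    where
    cyclicFlat⇒S* : ∀ Z → IsCyclicFlat (dualRank Mt) Z → ∃ λ A → IsCyclicFlat (dualRank M) A × Z ≡ S[ p ] A
    cyclicFlat⇒S* Z cyclicFlat with cyclicFlat⇒S (∁ Z) (isCyclicFlat-dual⇒∁ Mt cyclicFlat)
    ... | A , cyclicFlatA , ∁Z≡SA = ∁ A , cyclicFlat∁A , (begin
      Z                ≡⟨ SubsetBA.¬-involutive Z ⟨
      ∁ (∁ Z)          ≡⟨ cong ∁ ∁Z≡SA ⟩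
      ∁ (S[ p ] A)     ≡⟨ S-∁ p A ⟨
      S[ p ] (∁ A)     ∎)
      where
      open ≡-Reasoning
      cyclicFlat∁A : IsCyclicFlat (dualRank M) (∁ A)
      cyclicFlat∁A = isCyclicFlat-∁⇒dual M (subst (IsCyclicFlat (rank M)) (sym (SubsetBA.¬-involutive A)) cyclicFlatA)
    S-cyclicFlat* : ∀ A → IsCyclicFlat (dualRank M) A → IsCyclicFlat (dualRank Mt) (S[ p ] A)
    S-cyclicFlat* A cyclicFlat = isCyclicFlat-∁⇒dual Mt
      (subst (IsCyclicFlat (rank Mt)) (S-∁ p A) (S-cyclicFlat (∁ A) (isCyclicFlat-dual⇒∁ M cyclicFlat)))

expansion-unique : ∀ {t} {p : Fin m → Fin n} {r : Subset n → ℕ} (A B : Matroid m) →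
                   IsExpansion p t r (rank A) → IsExpansion p t r (rank B) → ∀ X → rank A X ≡ rank B X
expansion-unique {t = t} {p} {r} A B expansionA expansionB X =
  ≤-antisym (rank-≤-of-cyclicFlats A B (agree A B expansionA expansionB) X)
            (rank-≤-of-cyclicFlats B A (agree B A expansionB expansionA) X)
  where
  agree : ∀ C D → IsExpansion p t r (rank C) → IsExpansion p t r (rank D) →
          ∀ Z → IsCyclicFlat (rank D) Z → rank C Z ≤ rank D Z
  agree C D (_ , _ , rank-SC) (cyclicFlat⇒SD , _ , rank-SD) Z cyclicFlat with cyclicFlat⇒SD Z cyclicFlat
  ... | A′ , cyclicFlatA′ , refl = ≤-reflexive (trans (rank-SC A′ cyclicFlatA′) (sym (rank-SD A′ cyclicFlatA′)))

-- Relabelling along permutations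

module _ (π : Permutation′ n) {r s : Subset n → ℕ} (iso : ∀ X → s (S[ π ⟨$⟩ʳ_ ] X) ≡ r X) where

  private
    Sπ : Subset n → Subset n
    Sπ = S[ π ⟨$⟩ʳ_ ]
    Sπ⁅π⁆ : ∀ (e : Fin n) → Sπ ⁅ π ⟨$⟩ʳ e ⁆ ≡ ⁅ e ⁆
    Sπ⁅π⁆ e = trans (S-⁅⁆ π _) (cong ⁅_⁆ (inverseˡ π))

  isCyclicFlat-relabel : ∀ {Z} → IsCyclicFlat r Z → IsCyclicFlat s (Sπ Z)
  isCyclicFlat-relabel {Z} (flat , noColoops) = flat′ , noColoops′
    where
    flat′ : IsFlat s (Sπ Z)
    flat′ e e∉SπZ = begin-strict
      s (Sπ Z)                    ≡⟨ iso Z ⟩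
      r Z                         <⟨ flat (π ⟨$⟩ʳ e) (e∉SπZ ∘ ∈S⁺ (π ⟨$⟩ʳ_)) ⟩
      r (Z ∪ ⁅ π ⟨$⟩ʳ e ⁆)        ≡⟨ iso _ ⟨
      s (Sπ (Z ∪ ⁅ π ⟨$⟩ʳ e ⁆))   ≡⟨ cong s (trans (S-∪ _ Z _) (cong (Sπ Z ∪_) (Sπ⁅π⁆ e))) ⟩
      s (Sπ Z ∪ ⁅ e ⁆)            ∎
      where open ≤-Reasoning
    noColoops′ : NoColoops s (Sπ Z)
    noColoops′ e e∈SπZ = begin
      s (Sπ Z - e)                ≡⟨ cong s (trans (S-─ _ Z _) (cong (Sπ Z ─_) (Sπ⁅π⁆ e))) ⟨
      s (Sπ (Z - (π ⟨$⟩ʳ e)))       ≡⟨ iso _ ⟩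
      r (Z - (π ⟨$⟩ʳ e))            ≡⟨ noColoops (π ⟨$⟩ʳ e) (∈S⁻ (π ⟨$⟩ʳ_) e∈SπZ) ⟩
      r Z                         ≡⟨ iso Z ⟨
      s (Sπ Z)                    ∎
      where open ≡-Reasoning

isCyclicFlat-unrelabel : ∀ (π : Permutation′ n) {r s : Subset n → ℕ} → (∀ X → s (S[ π ⟨$⟩ʳ_ ] X) ≡ r X) →
                         ∀ {Z} → IsCyclicFlat s (S[ π ⟨$⟩ʳ_ ] Z) → IsCyclicFlat r Z
isCyclicFlat-unrelabel π {r} {s} iso {Z} cyclicFlat =
  subst (IsCyclicFlat r) (S[π⁻¹]∘S[π] π Z) (isCyclicFlat-relabel (Permutation.flip π) {s = r} iso⁻¹ cyclicFlat)
  where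
  iso⁻¹ : ∀ X → r (S[ π ⟨$⟩ˡ_ ] X) ≡ s X
  iso⁻¹ X = trans (sym (iso _)) (cong s (S[π]∘S[π⁻¹] π X))

relabel : Permutation′ n → Matroid n → Matroid n
relabel π M = record
  { rank        = λ X → rank M (S[ π ⟨$⟩ʳ_ ] X)
  ; rank-≤-card = λ X → ≤-trans (rank-≤-card M _) (≤-reflexive (∣S[π]∣≡∣∣ π X))
  ; rank-mono   = rank-mono M ∘ S-mono (π ⟨$⟩ʳ_)
  ; rank-submod = λ X Y → subst₂ (λ U V → rank M U + rank M V ≤ rank M (S[ π ⟨$⟩ʳ_ ] X) + rank M (S[ π ⟨$⟩ʳ_ ] Y))
                                 (sym (S-∪ _ X Y)) (sym (S-∩ _ X Y)) (rank-submod M _ _)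
  }

S[σ]∘S[p] : ∀ {p : Fin m → Fin n} (π : Permutation′ n) (σ : Permutation′ m) →
            (∀ i → p (σ ⟨$⟩ʳ i) ≡ π ⟨$⟩ʳ p i) → ∀ A → S[ σ ⟨$⟩ʳ_ ] (S[ p ] A) ≡ S[ p ] (S[ π ⟨$⟩ʳ_ ] A)
S[σ]∘S[p] {p = p} π σ σ-lifts-π A = trans (S-∘ _ p A) (trans (S-cong σ-lifts-π A) (sym (S-∘ p _ A)))

module _ {t} {p : Fin m → Fin n} {r r′ : Subset n → ℕ} {s : Subset m → ℕ}
         (π : Permutation′ n) (σ : Permutation′ m) (σ-lifts-π : ∀ i → p (σ ⟨$⟩ʳ i) ≡ π ⟨$⟩ʳ p i)
         (iso : ∀ X → r′ (S[ π ⟨$⟩ʳ_ ] X) ≡ r X) (expansion : IsExpansion p t r′ s) where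

  private
    Sπ : Subset n → Subset n
    Sπ = S[ π ⟨$⟩ʳ_ ]
    Sσ : Subset m → Subset m
    Sσ = S[ σ ⟨$⟩ʳ_ ]
    commute : ∀ A → Sσ (S[ p ] A) ≡ S[ p ] (Sπ A)
    commute = S[σ]∘S[p] π σ σ-lifts-π

  relabel-cyclicFlat⇒S : ∀ Z → IsCyclicFlat (s ∘ Sσ) Z → ∃ λ A → IsCyclicFlat r A × Z ≡ S[ p ] A
  relabel-cyclicFlat⇒S Z cyclicFlat with proj₁ expansion (Sσ Z) (isCyclicFlat-relabel σ {s = s} (λ _ → refl) cyclicFlat)
  ... | B , cyclicFlatB , SσZ≡SpB = A , cyclicFlatA , Z≡SpA
    where
    A : Subset n
    A = S[ π ⟨$⟩ˡ_ ] B
    SπA≡B : Sπ A ≡ B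
    SπA≡B = S[π]∘S[π⁻¹] π B
    cyclicFlatA : IsCyclicFlat r A
    cyclicFlatA = isCyclicFlat-unrelabel π {s = r′} iso (subst (IsCyclicFlat r′) (sym SπA≡B) cyclicFlatB)
    Sσ⁻¹ : Subset m → Subset m
    Sσ⁻¹ = S[ σ ⟨$⟩ˡ_ ]
    Z≡SpA : Z ≡ S[ p ] A
    Z≡SpA = begin
      Z                      ≡⟨ S[π⁻¹]∘S[π] σ Z ⟨
      Sσ⁻¹ (Sσ Z)            ≡⟨ cong Sσ⁻¹ SσZ≡SpB ⟩
      Sσ⁻¹ (S[ p ] B)        ≡⟨ cong (Sσ⁻¹ ∘ S[ p ]) SπA≡B ⟨
      Sσ⁻¹ (S[ p ] (Sπ A))   ≡⟨ cong Sσ⁻¹ (commute A) ⟨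
      Sσ⁻¹ (Sσ (S[ p ] A))   ≡⟨ S[π⁻¹]∘S[π] σ (S[ p ] A) ⟩
      S[ p ] A               ∎
      where open ≡-Reasoning

  relabel-S-cyclicFlat : ∀ A → IsCyclicFlat r A → IsCyclicFlat (s ∘ Sσ) (S[ p ] A)
  relabel-S-cyclicFlat A cyclicFlat = isCyclicFlat-unrelabel σ {s = s} (λ _ → refl)
    (subst (IsCyclicFlat s) (sym (commute A)) (proj₁ (proj₂ expansion) (Sπ A) (isCyclicFlat-relabel π {s = r′} iso cyclicFlat)))

  relabel-rank-S : ∀ A → IsCyclicFlat r A → s (Sσ (S[ p ] A)) ≡ t * r A
  relabel-rank-S A cyclicFlat = begin
    s (Sσ (S[ p ] A))   ≡⟨ cong s (commute A) ⟩
    s (S[ p ] (Sπ A))   ≡⟨ proj₂ (proj₂ expansion) (Sπ A) (isCyclicFlat-relabel π {s = r′} iso cyclicFlat) ⟩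
    t * r′ (Sπ A)       ≡⟨ cong (t *_) (iso A) ⟩
    t * r A             ∎
    where open ≡-Reasoning

  expansion-relabel : IsExpansion p t r (s ∘ Sσ)
  expansion-relabel = relabel-cyclicFlat⇒S , relabel-S-cyclicFlat , relabel-rank-S

fibres-permutation : ∀ (q q′ : Fin m → Fin n) → (∀ e → ∣ S[ q ] ⁅ e ⁆ ∣ ≡ ∣ S[ q′ ] ⁅ e ⁆ ∣) →
                     Σ (Permutation′ m) λ σ → ∀ i → q′ (σ ⟨$⟩ʳ i) ≡ q i
fibres-permutation {zero}  q q′ sameSizes = Permutation.id , λ ()
fibres-permutation {suc m} q q′ sameSizes with Nonempty-∣∣ (sameSizes (q zero)) (zero , ∈S⁺ q (x∈⁅x⁆ (q zero)))
... | j , j∈fibre = insert zero j (proj₁ rest) , lifts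
  where
  q′j≡q0 : q′ j ≡ q zero
  q′j≡q0 = x∈⁅y⁆⇒x≡y (q zero) (∈S⁻ q′ j∈fibre)
  sameSizes′ : ∀ e → ∣ S[ q ∘ suc ] ⁅ e ⁆ ∣ ≡ ∣ S[ q′ ∘ punchIn j ] ⁅ e ⁆ ∣
  sameSizes′ e = ∣∷∣-cancel (lookup ⁅ e ⁆ (q zero)) {S[ q ∘ suc ] ⁅ e ⁆} {S[ q′ ∘ punchIn j ] ⁅ e ⁆} (begin
    ∣ S[ q ] ⁅ e ⁆ ∣                                         ≡⟨ sameSizes e ⟩
    ∣ S[ q′ ] ⁅ e ⁆ ∣                                        ≡⟨ ∣tabulate∣-punchIn (lookup ⁅ e ⁆ ∘ q′) j ⟩
    ∣ lookup ⁅ e ⁆ (q′ j) ∷ S[ q′ ∘ punchIn j ] ⁅ e ⁆ ∣      ≡⟨ cong (λ x → ∣ lookup ⁅ e ⁆ x ∷ S[ q′ ∘ punchIn j ] ⁅ e ⁆ ∣) q′j≡q0 ⟩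
    ∣ lookup ⁅ e ⁆ (q zero) ∷ S[ q′ ∘ punchIn j ] ⁅ e ⁆ ∣    ∎)
    where open ≡-Reasoning
  rest : Σ (Permutation′ m) λ σ → ∀ i → q′ (punchIn j (σ ⟨$⟩ʳ i)) ≡ q (suc i)
  rest = fibres-permutation (q ∘ suc) (q′ ∘ punchIn j) sameSizes′
  lifts : ∀ i → q′ (insert zero j (proj₁ rest) ⟨$⟩ʳ i) ≡ q i
  lifts zero    = q′j≡q0
  lifts (suc i) = trans (cong q′ (insert-punchIn zero j (proj₁ rest) i)) (proj₂ rest i)

lemma3p5 : ∀ {m n : ℕ} (t : ℕ) (p : Fin m → Fin n) → BlocksOfSize p t →
    (M : Matroid n) (Mt : Matroid m) → IsExpansion p t (rank M) (rank Mt) →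
    IsExpansion p t (dualRank M) (dualRank Mt)
    × (SelfDual M → SelfDual Mt)
lemma3p5 t p blocks M Mt expansion = dualExpansion , selfDual
  where
  dualExpansion : IsExpansion p t (dualRank M) (dualRank Mt)
  dualExpansion = expansion-dual blocks M Mt expansion
  selfDual : SelfDual M → SelfDual Mt
  selfDual (π , M≅M*) with fibres-permutation ((π ⟨$⟩ʳ_) ∘ p) p (λ e → trans (blocks-∘ {p = p} π blocks e) (sym (blocks e)))
  ... | σ , σ-lifts-π = σ , λ X → sym (expansion-unique {t = t} {r = rank M} Mt (relabel σ (dual Mt)) expansion relabelledExpansion X)
    where
    relabelledExpansion : IsExpansion p t (rank M) (rank (relabel σ (dual Mt)))
    relabelledExpansion = expansion-relabel {t = t} π σ σ-lifts-π M≅M* dualExpansion
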